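{- Let $r\ge 1$ be odd and let $n\ge 3$ be odd. Let $rK_{1,n}$ denote the disjoint union of $r$ copies of the star $K_{1,n}$. Then $\chi_{la}(rK_{1,n})=rn+1$.
   Context: For a graph $G=(V,E)$ without $K_2$ components, a bijection $f:E\to\{1,2,\dots,|E|\}$ induces the weight $w(u)=\sum_{uv\in E} f(uv)$ of each vertex $u$. The bijection $f$ is a local antimagic labeling if $w(u)\neq w(v)$ for every edge $uv$. The local antimagic chromatic number $\chi_{la}(G)$ is the minimum number of distinct weights over all local antimagic labelings of $G$. $K_{1,n}$ is the star with one center and $n$ leaves. -}

module Defs where

open import Data.Nat using (ℕ; zero; suc; _+_; _*_; _≤_)
open import Data.Nat.Properties using () renaming (_≟_ to _≟ℕ_)
open import Data.Fin using (Fin; toℕ; combine; remQuot) renaming (zero to fzero; suc to fsuc)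
open import Data.Fin.Properties using (_≟_)
open import Data.List using (List; map; length; deduplicate; allFin)
open import Data.Nat.ListAction using (sum)
open import Data.Product using (Σ; ∃; _×_; _,_; proj₁; proj₂)
open import Data.Bool using (Bool; if_then_else_; _∨_)
open import Relation.Nullary using (¬_)
open import Relation.Nullary.Decidable using (⌊_⌋)
open import Relation.Binary.PropositionalEquality using (_≡_)
open import Function.Definitions using (Bijective)

Odd : ℕ → Set
Odd n = ∃ λ k → n ≡ suc (2 * k)

record Graph : Set where
  field
    V   : ℕ
    E   : ℕ
    src : Fin E → Fin V
    tgt : Fin E → Fin V
open Graph public

-- A bijection f : E → {1,…,|E|}; edge e gets label  suc (toℕ (f e)).
record Labeling (G : Graph) : Set where
  field
    f     : Fin (E G) → Fin (E G)
    f-bij : Bijective _≡_ _≡_ f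
open Labeling public

label : {G : Graph} → Labeling G → Fin (E G) → ℕ
label L e = suc (toℕ (f L e))

incident : (G : Graph) → Fin (V G) → Fin (E G) → Bool
incident G u e = ⌊ u ≟ src G e ⌋ ∨ ⌊ u ≟ tgt G e ⌋

weight : {G : Graph} → Labeling G → Fin (V G) → ℕ
weight {G} L u = sum (map (λ e → if incident G u e then label L e else 0) (allFin (E G)))

IsLocalAntimagic : {G : Graph} → Labeling G → Set
IsLocalAntimagic {G} L = ∀ e → ¬ (weight L (src G e) ≡ weight L (tgt G e))

numWeights : {G : Graph} → Labeling G → ℕ
numWeights {G} L = length (deduplicate _≟ℕ_ (map (weight L) (allFin (V G))))

ChiLaIs : Graph → ℕ → Set
ChiLaIs G k =
  (Σ (Labeling G) λ L → IsLocalAntimagic L × numWeights L ≡ k)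
  × (∀ (L : Labeling G) → IsLocalAntimagic L → k ≤ numWeights L)

-- r K_{1,n}: vertices Fin (r * suc n), vertex (i , 0) is the centre of
-- copy i and (i , suc j) its j-th leaf; edges Fin (r * n), edge (i , j)
-- joins the centre of copy i with its j-th leaf.
starForest : ℕ → ℕ → Graph
starForest r n = record
  { V   = r * suc n
  ; E   = r * n
  ; src = λ e → combine {r} {suc n} (proj₁ (remQuot {r} n e)) fzero
  ; tgt = λ e → combine {r} {suc n} (proj₁ (remQuot {r} n e)) (fsuc (proj₂ (remQuot {r} n e)))
  }

-- A leaf has the label of its edge as weight, and a centre the sum of its n ≥ 2 labels,
-- which exceeds each of them. So every labelling is local antimagic, the leaves realise all
-- the labels 1, …, rn as weights, and the centre of the star carrying rn adds one more:
-- at least rn + 1 weights. Conversely, for r = 2m + 1 and odd n, give edge (i, j) the label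
-- r j + c_j(i) + 1, where c_0, c_1, c_2 are the columns of a 3 × r magic rectangle and the
-- remaining columns pair up as x, 2m − x. Each c_j permutes {0, …, 2m}, so this is a
-- labelling, and all row sums agree, so all centres share one weight: rn + 1 weights in all.
module Submission where

open import Defs
open import Data.Nat using (ℕ; zero; suc; _+_; _*_; _∸_; _≤_; _<_; _≤?_; z≤n; s≤s; s≤s⁻¹; NonZero)
open import Data.Nat.Properties
open import Data.Nat.Solver using (module +-*-Solver)
open import Data.Fin using (Fin; toℕ; combine; remQuot; fromℕ<; cast; punchOut; _↑ˡ_; _↑ʳ_)
  renaming (zero to fzero; suc to fsuc)
open import Data.Fin.Properties
  using ( toℕ-fromℕ<; toℕ<n; toℕ-injective; toℕ-cast; toℕ-combine; remQuot-combine
        ; combine-injective; combine-injectiveˡ; combine-injectiveʳ; combine-surjective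
        ; injective⇒≤; punchOut-injective; any? )
  renaming (_≟_ to _≟ᶠ_; suc-injective to fsuc-injective)
open import Data.Bool using (true; false; if_then_else_)
open import Data.List using (List; _∷_; map; length; lookup; tabulate; allFin; deduplicate)
open import Data.List.Properties using (map-tabulate; length-map; length-tabulate)
import Data.Nat.ListAction as List
open import Data.List.Membership.Propositional using (_∈_)
open import Data.List.Membership.Propositional.Properties
  using (∈-lookup; ∈-allFin; ∈-map⁺; ∈-map⁻; ∈-deduplicate⁺; ∈-deduplicate⁻)
open import Data.List.Relation.Binary.Subset.Propositional using (_⊆_)
open import Data.List.Relation.Unary.Any using (here; there; index)
open import Data.List.Relation.Unary.Any.Properties using (lookup-index)
import Data.List.Relation.Unary.All as All
open import Data.List.Relation.Unary.AllPairs using (_∷_)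
open import Data.List.Relation.Unary.Unique.Propositional using (Unique)
open import Data.List.Relation.Unary.Unique.Propositional.Properties using (map⁺; allFin⁺)
open import Data.List.Relation.Unary.Unique.DecPropositional.Properties _≟_ using (deduplicate-!)
open import Data.Product using (_,_; proj₂; ∃; ∃₂)
open import Data.Sum using (_⊎_; inj₁; inj₂)
open import Relation.Nullary using (yes; no; contradiction)
open import Relation.Binary.PropositionalEquality
open import Function using (_∘_)
open import Function.Definitions using (Injective; Surjective)
open import Algebra.Properties.CommutativeMonoid.Sum +-0-commutativeMonoid
  using (sum; sum-syntax; sum-cong-≗; sum-replicate-zero; ∑-distrib-+)
open +-*-Solver

private variable
  A : Set

sum-allFin : ∀ {k} (φ : Fin k → ℕ) → List.sum (map φ (allFin k)) ≡ ∑[ x < k ] φ x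
sum-allFin φ = trans (cong List.sum (map-tabulate (λ x → x) φ)) (sum-tabulate φ)
  where
  sum-tabulate : ∀ {k} (φ : Fin k → ℕ) → List.sum (tabulate φ) ≡ ∑[ x < k ] φ x
  sum-tabulate {zero}  φ = refl
  sum-tabulate {suc k} φ = cong (φ fzero +_) (sum-tabulate (λ x → φ (fsuc x)))

∑-zero : ∀ {k} (φ : Fin k → ℕ) → (∀ x → φ x ≡ 0) → ∑[ x < k ] φ x ≡ 0
∑-zero {k} φ φ≡0 = trans (sum-cong-≗ φ≡0) (sum-replicate-zero k)

∑-single : ∀ {k} (φ : Fin k → ℕ) (a : Fin k) → (∀ x → x ≢ a → φ x ≡ 0) → ∑[ x < k ] φ x ≡ φ a
∑-single φ fzero     φ≡0 = trans (cong (φ fzero +_) (∑-zero _ (λ x → φ≡0 (fsuc x) λ ()))) (+-identityʳ _)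
∑-single φ (fsuc a)  φ≡0 = cong₂ _+_ (φ≡0 fzero λ ()) (∑-single _ a λ x x≢a → φ≡0 (fsuc x) (x≢a ∘ fsuc-injective))

∑-↑ : ∀ a b (φ : Fin (a + b) → ℕ) → ∑[ x < a + b ] φ x ≡ ∑[ i < a ] φ (i ↑ˡ b) + ∑[ j < b ] φ (a ↑ʳ j)
∑-↑ zero    b φ = refl
∑-↑ (suc a) b φ = trans (cong (φ fzero +_) (∑-↑ a b (λ x → φ (fsuc x)))) (sym (+-assoc (φ fzero) _ _))

∑-combine : ∀ m n (φ : Fin (m * n) → ℕ) → ∑[ x < m * n ] φ x ≡ ∑[ i < m ] ∑[ j < n ] φ (combine i j)
∑-combine zero    n φ = refl
∑-combine (suc m) n φ = trans (∑-↑ n (m * n) φ) (cong (∑[ j < n ] φ (j ↑ˡ (m * n)) +_) (∑-combine m n (λ x → φ (n ↑ʳ x))))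

term≤∑ : ∀ {k} (φ : Fin k → ℕ) (a : Fin k) → φ a ≤ ∑[ x < k ] φ x
term≤∑ φ fzero    = m≤m+n _ _
term≤∑ φ (fsuc a) = ≤-trans (term≤∑ (λ x → φ (fsuc x)) a) (m≤n+m _ _)

term<∑ : ∀ {k} (φ : Fin k → ℕ) → 1 < k → (∀ x → 0 < φ x) → ∀ a → φ a < ∑[ x < k ] φ x
term<∑ φ (s≤s (s≤s _)) φ>0 fzero    = m<m+n (φ fzero) (≤-trans (φ>0 (fsuc fzero)) (term≤∑ (λ x → φ (fsuc x)) fzero))
term<∑ φ (s≤s (s≤s _)) φ>0 (fsuc a) = +-mono-≤ (φ>0 fzero) (term≤∑ (λ x → φ (fsuc x)) a)

injective⇒surjective : ∀ {k} {f : Fin k → Fin k} → Injective _≡_ _≡_ f → Surjective _≡_ _≡_ f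
injective⇒surjective {zero}      _     ()
injective⇒surjective {suc k} {f} f-inj y with any? (λ x → f x ≟ᶠ y)
... | yes (x , fx≡y) = x , λ { refl → fx≡y }
... | no ∄x = contradiction (injective⇒≤ g-inj) (<-irrefl refl)
  where
  y≢f : ∀ x → y ≢ f x
  y≢f x y≡fx = ∄x (x , sym y≡fx)
  g : Fin (suc k) → Fin k
  g x = punchOut (y≢f x)
  g-inj : Injective _≡_ _≡_ g
  g-inj {a} {b} = f-inj ∘ punchOut-injective (y≢f a) (y≢f b)

cast-injective : ∀ {k l} .(k≡l : k ≡ l) → Injective _≡_ _≡_ (cast k≡l)
cast-injective k≡l {a} {b} eq = toℕ-injective (trans (sym (toℕ-cast k≡l a)) (trans (cong toℕ eq) (toℕ-cast k≡l b)))

Unique⇒lookup-injective : {xs : List A} → Unique xs → Injective _≡_ _≡_ (lookup xs)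
Unique⇒lookup-injective {xs = x ∷ xs} (x∉ ∷ u) {fzero}  {fzero}  _ = refl
Unique⇒lookup-injective {xs = x ∷ xs} (x∉ ∷ u) {fzero}  {fsuc j} e = contradiction e (All.lookup x∉ (∈-lookup j))
Unique⇒lookup-injective {xs = x ∷ xs} (x∉ ∷ u) {fsuc i} {fzero}  e = contradiction (sym e) (All.lookup x∉ (∈-lookup i))
Unique⇒lookup-injective {xs = x ∷ xs} (x∉ ∷ u) {fsuc i} {fsuc j} e = cong fsuc (Unique⇒lookup-injective u e)

Unique-⊆⇒length≤ : {xs ys : List A} → Unique xs → xs ⊆ ys → length xs ≤ length ys
Unique-⊆⇒length≤ {xs = xs} {ys} u xs⊆ys = injective⇒≤ {f = position} position-inj
  where
  position : Fin (length xs) → Fin (length ys)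
  position k = index (xs⊆ys (∈-lookup k))
  position-inj : Injective _≡_ _≡_ position
  position-inj {a} {b} eq = Unique⇒lookup-injective u (begin
    lookup xs a                 ≡⟨ lookup-index (xs⊆ys (∈-lookup a)) ⟩
    lookup ys (position a)      ≡⟨ cong (lookup ys) eq ⟩
    lookup ys (position b)      ≡⟨ lookup-index (xs⊆ys (∈-lookup b)) ⟨
    lookup xs b                 ∎)
    where open ≡-Reasoning

module _ (G : Graph) where

  endpoint⇒incident : ∀ {u e} → u ≡ src G e ⊎ u ≡ tgt G e → incident G u e ≡ true
  endpoint⇒incident {u} {e} (inj₁ u≡src) with u ≟ᶠ src G e
  ... | yes _     = refl
  ... | no  u≢src = contradiction u≡src u≢src
  endpoint⇒incident {u} {e} (inj₂ u≡tgt) with u ≟ᶠ src G e | u ≟ᶠ tgt G e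
  ... | yes _ | _         = refl
  ... | no  _ | yes _     = refl
  ... | no  _ | no  u≢tgt = contradiction u≡tgt u≢tgt

  incident⇒endpoint : ∀ {u e} → incident G u e ≡ true → u ≡ src G e ⊎ u ≡ tgt G e
  incident⇒endpoint {u} {e} inc with u ≟ᶠ src G e | u ≟ᶠ tgt G e
  ... | yes u≡src | _         = inj₁ u≡src
  ... | no  _     | yes u≡tgt = inj₂ u≡tgt

labels : ℕ → List ℕ
labels k = map (suc ∘ toℕ) (allFin k)

length-labels : ∀ k → length (labels k) ≡ k
length-labels k = trans (length-map (suc ∘ toℕ) (allFin k)) (length-tabulate (λ x → x))

labels-unique : ∀ k → Unique (labels k)
labels-unique k = map⁺ (toℕ-injective ∘ suc-injective) (allFin⁺ k)

∈labels⇒≤ : ∀ {k x} → x ∈ labels k → x ≤ k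
∈labels⇒≤ x∈ with _ , _ , refl ← ∈-map⁻ (suc ∘ toℕ) x∈ = toℕ<n _

module _ {G : Graph} (L : Labeling G) where

  contribution : Fin (V G) → Fin (E G) → ℕ
  contribution u e = if incident G u e then label L e else 0

  weight≡∑ : ∀ u → weight L u ≡ ∑[ e < E G ] contribution u e
  weight≡∑ u = sum-allFin (contribution u)

  contribution-incident : ∀ {u e} → incident G u e ≡ true → contribution u e ≡ label L e
  contribution-incident inc rewrite inc = refl

  contribution-nonincident : ∀ {u e} → incident G u e ≢ true → contribution u e ≡ 0
  contribution-nonincident {u} {e} ¬inc with incident G u e
  ... | true  = contradiction refl ¬inc
  ... | false = refl

  weight-pendant : ∀ u {e} → incident G u e ≡ true → (∀ {e′} → incident G u e′ ≡ true → e′ ≡ e) →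
                   weight L u ≡ label L e
  weight-pendant u {e} inc only = begin
    weight L u                     ≡⟨ weight≡∑ u ⟩
    ∑[ e′ < E G ] contribution u e′ ≡⟨ ∑-single (contribution u) e (λ e′ e′≢e → contribution-nonincident {u} (e′≢e ∘ only)) ⟩
    contribution u e               ≡⟨ contribution-incident {u} inc ⟩
    label L e                      ∎
    where open ≡-Reasoning

  label∈labels : ∀ e → label L e ∈ labels (E G)
  label∈labels e = ∈-map⁺ (suc ∘ toℕ) (∈-allFin (f L e))

  label-surjective : ∀ k → ∃ λ e → label L e ≡ suc (toℕ k)
  label-surjective k = let e , fe≡k = proj₂ (f-bij L) k in e , cong (suc ∘ toℕ) (fe≡k refl)

  ∃-label≡∣E∣ : .{{NonZero (E G)}} → ∃ λ e → label L e ≡ E G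
  ∃-label≡∣E∣ = let e , label≡ = label-surjective (fromℕ< (m≤pred[n]⇒suc[m]≤n {n = E G} ≤-refl)) in
    e , trans label≡ (trans (cong suc (toℕ-fromℕ< _)) (suc-pred (E G)))

  weights : List ℕ
  weights = deduplicate _≟_ (map (weight L) (allFin (V G)))

  weight∈weights : ∀ u → weight L u ∈ weights
  weight∈weights u = ∈-deduplicate⁺ _≟_ (∈-map⁺ (weight L) (∈-allFin u))

  ∈weights⇒ : ∀ {x} → x ∈ weights → ∃ λ u → x ≡ weight L u
  ∈weights⇒ x∈ = let u , _ , x≡ = ∈-map⁻ (weight L) (∈-deduplicate⁻ _≟_ _ x∈) in u , x≡

module StarForest (r n : ℕ) where

  G : Graph
  G = starForest r n

  centre : Fin r → Fin (r * suc n)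
  centre i = combine i fzero

  leaf : Fin r → Fin n → Fin (r * suc n)
  leaf i j = combine i (fsuc j)

  centre≢leaf : ∀ i i′ j → centre i ≢ leaf i′ j
  centre≢leaf i i′ j eq with () ← combine-injectiveʳ i fzero i′ (fsuc j) eq

  src-combine : ∀ i j → src G (combine i j) ≡ centre i
  src-combine i j = cong (λ (i , _) → centre i) (remQuot-combine i j)

  tgt-combine : ∀ i j → tgt G (combine i j) ≡ leaf i j
  tgt-combine i j = cong (λ (i , j) → leaf i j) (remQuot-combine i j)

  vertex-cases : ∀ u → (∃ λ i → u ≡ centre i) ⊎ (∃₂ λ i j → u ≡ leaf i j)
  vertex-cases u with combine-surjective {r} {suc n} u
  ... | i , fzero  , refl = inj₁ (i , refl)
  ... | i , fsuc j , refl = inj₂ (i , j , refl)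

  incident-centre : ∀ {i i′ j} → incident G (centre i) (combine i′ j) ≡ true → i′ ≡ i
  incident-centre {i} {i′} {j} inc with incident⇒endpoint G inc
  ... | inj₁ eq = sym (combine-injectiveˡ i fzero i′ fzero (trans eq (src-combine i′ j)))
  ... | inj₂ eq = contradiction (trans eq (tgt-combine i′ j)) (centre≢leaf i i′ j)

  incident-leaf : ∀ {i j e} → incident G (leaf i j) e ≡ true → e ≡ combine i j
  incident-leaf {i} {j} {e} inc with combine-surjective {r} {n} e
  ... | i′ , j′ , refl with incident⇒endpoint G inc
  ... | inj₁ eq = contradiction (sym (trans eq (src-combine i′ j′))) (centre≢leaf i′ i j)
  ... | inj₂ eq with refl , refl ← combine-injective i (fsuc j) i′ (fsuc j′) (trans eq (tgt-combine i′ j′)) = refl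

  module _ (L : Labeling G) where

    weight-leaf : ∀ i j → weight L (leaf i j) ≡ label L (combine i j)
    weight-leaf i j = weight-pendant L (leaf i j) (endpoint⇒incident G (inj₂ (sym (tgt-combine i j)))) incident-leaf

    weight-centre : ∀ i → weight L (centre i) ≡ ∑[ j < n ] label L (combine i j)
    weight-centre i = begin
      weight L (centre i)                        ≡⟨ weight≡∑ L (centre i) ⟩
      ∑[ e < r * n ] contribution L (centre i) e ≡⟨ ∑-combine r n (contribution L (centre i)) ⟩
      ∑[ i′ < r ] ∑[ j < n ] row i′ j            ≡⟨ ∑-single (λ i′ → ∑[ j < n ] row i′ j) i other-rows-vanish ⟩
      ∑[ j < n ] row i j                         ≡⟨ sum-cong-≗ own-row ⟩
      ∑[ j < n ] label L (combine i j)           ∎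
      where
      open ≡-Reasoning
      row : Fin r → Fin n → ℕ
      row i′ j = contribution L (centre i) (combine i′ j)
      own-row : ∀ j → row i j ≡ label L (combine i j)
      own-row j = contribution-incident L {centre i} (endpoint⇒incident G (inj₁ (sym (src-combine i j))))
      other-rows-vanish : ∀ i′ → i′ ≢ i → ∑[ j < n ] row i′ j ≡ 0
      other-rows-vanish i′ i′≢i = ∑-zero (row i′) λ j → contribution-nonincident L {centre i} (i′≢i ∘ incident-centre)

    label<weight-centre : 1 < n → ∀ i j → label L (combine i j) < weight L (centre i)
    label<weight-centre 1<n i j = subst (label L (combine i j) <_) (sym (weight-centre i))
      (term<∑ (λ j → label L (combine i j)) 1<n (λ _ → s≤s z≤n) j)

    isLocalAntimagic : 1 < n → IsLocalAntimagic L
    isLocalAntimagic 1<n e w≡w with i , j , refl ← combine-surjective {r} {n} e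
      rewrite src-combine i j | tgt-combine i j | weight-leaf i j
      = <⇒≢ (label<weight-centre 1<n i j) (sym w≡w)

    labels⊆weights : labels (r * n) ⊆ weights L
    labels⊆weights x∈ with k , _ , refl ← ∈-map⁻ (suc ∘ toℕ) x∈ with label-surjective L k
    ... | e , label≡ with i , j , refl ← combine-surjective {r} {n} e =
      subst (_∈ weights L) (trans (weight-leaf i j) label≡) (weight∈weights L (leaf i j))

    numWeights-lower : .{{NonZero (r * n)}} → 1 < n → r * n + 1 ≤ numWeights L
    numWeights-lower 1<n
      with e , label≡rn ← ∃-label≡∣E∣ L
      with i , j , refl ← combine-surjective {r} {n} e = begin
      r * n + 1                          ≡⟨ +-comm (r * n) 1 ⟩
      suc (r * n)                        ≡⟨ cong suc (length-labels (r * n)) ⟨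
      length (big ∷ labels (r * n))      ≤⟨ Unique-⊆⇒length≤ (big∉labels ∷ labels-unique (r * n)) ⊆weights ⟩
      numWeights L                       ∎
      where
      open ≤-Reasoning
      big : ℕ
      big = weight L (centre i)
      rn<big : r * n < big
      rn<big = subst (_< big) label≡rn (label<weight-centre 1<n i j)
      big∉labels : All.All (big ≢_) (labels (r * n))
      big∉labels = All.tabulate λ x∈ big≡x → <⇒≱ rn<big (subst (_≤ r * n) (sym big≡x) (∈labels⇒≤ x∈))
      ⊆weights : big ∷ labels (r * n) ⊆ weights L
      ⊆weights (here refl) = weight∈weights L (centre i)
      ⊆weights (there x∈)  = labels⊆weights x∈

    numWeights-upper : ∀ R → (∀ i → weight L (centre i) ≡ R) → numWeights L ≤ r * n + 1
    numWeights-upper R centres≡R = begin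
      numWeights L                 ≤⟨ Unique-⊆⇒length≤ (deduplicate-! _) weights⊆ ⟩
      length (R ∷ labels (r * n))  ≡⟨ cong suc (length-labels (r * n)) ⟩
      suc (r * n)                  ≡⟨ +-comm 1 (r * n) ⟩
      r * n + 1                    ∎
      where
      open ≤-Reasoning
      weights⊆ : weights L ⊆ R ∷ labels (r * n)
      weights⊆ x∈ with u , refl ← ∈weights⇒ L x∈ with vertex-cases u
      ... | inj₁ (i , refl)     = here (centres≡R i)
      ... | inj₂ (i , j , refl) = there (subst (_∈ labels (r * n)) (sym (weight-leaf i j)) (label∈labels L (combine i j)))

-- For x ≤ 2m the columns x, σ m x, τ m x form a 3 × (2m+1) magic rectangle:
-- each is a permutation of {0, …, 2m} and every row sums to 3m.
σ : ℕ → ℕ → ℕ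
σ m x with x ≤? m
... | yes _ = x + m
... | no  _ = x ∸ suc m

τ : ℕ → ℕ → ℕ
τ m x with x ≤? m
... | yes _ = 2 * (m ∸ x)
... | no  _ = suc (2 * (2 * m ∸ x))

data Half (m x : ℕ) : Set where
  lower : ∀ d → x + d ≡ m → Half m x
  upper : ∀ k d → suc m + k ≡ x → suc k + d ≡ m → Half m x

half : ∀ m x → x ≤ 2 * m → Half m x
half m x x≤2m with x ≤? m
... | yes x≤m = lower (m ∸ x) (m+[n∸m]≡n x≤m)
... | no  x≰m = upper k (m ∸ suc k) m+1+k≡x (m+[n∸m]≡n k<m)
  where
  k = x ∸ suc m
  m+1+k≡x : suc m + k ≡ x
  m+1+k≡x = m+[n∸m]≡n (≰⇒> x≰m)
  k<m : k < m
  k<m = +-cancelˡ-≤ (suc m) (suc k) m (begin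
    suc m + suc k  ≡⟨ +-suc (suc m) k ⟩
    suc (suc m + k) ≡⟨ cong suc m+1+k≡x ⟩
    suc x          ≤⟨ s≤s x≤2m ⟩
    suc (2 * m)     ≡⟨ solve 1 (λ m → con 1 :+ con 2 :* m := (con 1 :+ m) :+ m) refl m ⟩
    suc m + m       ∎)
    where open ≤-Reasoning

σ-lower : ∀ m x {d} → x + d ≡ m → σ m x ≡ x + m
σ-lower m x {d} x+d≡m with x ≤? m
... | yes _   = refl
... | no  x≰m = contradiction (subst (x ≤_) x+d≡m (m≤m+n x d)) x≰m

σ-upper : ∀ m x {k} → suc m + k ≡ x → σ m x ≡ k
σ-upper m _ {k} refl with suc m + k ≤? m
... | yes x≤m = contradiction x≤m (<⇒≱ (m≤m+n (suc m) k))
... | no  _   = m+n∸m≡n (suc m) k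

τ-lower : ∀ m x {d} → x + d ≡ m → τ m x ≡ 2 * d
τ-lower _ x {d} refl with x ≤? x + d
... | yes _   = cong (2 *_) (m+n∸m≡n x d)
... | no  x≰m = contradiction (m≤m+n x d) x≰m

τ-upper : ∀ m x {k d} → suc m + k ≡ x → suc k + d ≡ m → τ m x ≡ suc (2 * d)
τ-upper _ _ {k} {d} refl refl with suc (suc k + d) + k ≤? suc k + d
... | yes x≤m = contradiction x≤m (<⇒≱ (m≤m+n (suc (suc k + d)) k))
... | no  _   = cong (suc ∘ (2 *_)) (trans (cong (_∸ x) 2m≡x+d) (m+n∸m≡n x d))
  where
  x = suc (suc k + d) + k
  2m≡x+d : 2 * (suc k + d) ≡ x + d
  2m≡x+d = solve 2 (λ k d → con 2 :* (con 1 :+ k :+ d) := ((con 1 :+ (con 1 :+ k :+ d)) :+ k) :+ d) refl k d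

στ-sum : ∀ m x → x ≤ 2 * m → x + (σ m x + τ m x) ≡ 3 * m
στ-sum m x x≤2m with half m x x≤2m
... | lower d refl = begin
  x + (σ (x + d) x + τ (x + d) x) ≡⟨ cong (x +_) (cong₂ _+_ (σ-lower (x + d) x refl) (τ-lower (x + d) x refl)) ⟩
  x + (x + (x + d) + 2 * d)       ≡⟨ solve 2 (λ x d → x :+ (x :+ (x :+ d) :+ con 2 :* d) := con 3 :* (x :+ d)) refl x d ⟩
  3 * (x + d)                     ∎
  where open ≡-Reasoning
... | upper k d refl refl = begin
  y + (σ m′ y + τ m′ y) ≡⟨ cong (y +_) (cong₂ _+_ (σ-upper m′ y refl) (τ-upper m′ y refl refl)) ⟩
  y + (k + suc (2 * d)) ≡⟨ solve 2 (λ k d → con 1 :+ (con 1 :+ k :+ d) :+ k :+ (k :+ (con 1 :+ con 2 :* d)) := con 3 :* (con 1 :+ k :+ d)) refl k d ⟩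
  3 * m′                ∎
  where
  open ≡-Reasoning
  m′ = suc k + d
  y = suc m′ + k

σ-≤ : ∀ m x → x ≤ 2 * m → σ m x ≤ 2 * m
σ-≤ m x x≤2m with half m x x≤2m
... | lower d refl = begin
  σ (x + d) x       ≡⟨ σ-lower (x + d) x refl ⟩
  x + (x + d)       ≤⟨ +-mono-≤ (m≤m+n x d) (m≤m+n (x + d) 0) ⟩
  2 * (x + d)       ∎
  where open ≤-Reasoning
... | upper k d refl refl = begin
  σ m′ (suc m′ + k) ≡⟨ σ-upper m′ (suc m′ + k) refl ⟩
  k                 ≤⟨ ≤-trans (n≤1+n k) (m≤m+n (suc k) d) ⟩
  m′                ≤⟨ m≤m+n m′ (m′ + 0) ⟩
  2 * m′            ∎
  where
  open ≤-Reasoning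
  m′ = suc k + d

τ-≤ : ∀ m x → x ≤ 2 * m → τ m x ≤ 2 * m
τ-≤ m x x≤2m with half m x x≤2m
... | lower d refl = begin
  τ (x + d) x       ≡⟨ τ-lower (x + d) x refl ⟩
  2 * d             ≤⟨ *-monoʳ-≤ 2 (m≤n+m d x) ⟩
  2 * (x + d)       ∎
  where open ≤-Reasoning
... | upper k d refl refl = begin
  τ m′ (suc m′ + k)         ≡⟨ τ-upper m′ (suc m′ + k) refl refl ⟩
  suc (2 * d)               ≤⟨ m≤m+n (suc (2 * d)) (suc (2 * k)) ⟩
  suc (2 * d) + suc (2 * k) ≡⟨ solve 2 (λ k d → con 1 :+ con 2 :* d :+ (con 1 :+ con 2 :* k) := con 2 :* (con 1 :+ k :+ d)) refl k d ⟩
  2 * m′                    ∎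
  where
  open ≤-Reasoning
  m′ = suc k + d

σ-lower≢σ-upper : ∀ m x y {d₁ k d₂} → x + d₁ ≡ m → suc m + k ≡ y → suc k + d₂ ≡ m → σ m x ≢ σ m y
σ-lower≢σ-upper m x y {_} {k} {d₂} x+d≡m y≡ k+d≡m σx≡σy = <⇒≢ k<σx (sym (trans σx≡σy (σ-upper m y y≡)))
  where
  k<σx : k < σ m x
  k<σx = subst (k <_) (sym (σ-lower m x x+d≡m)) (≤-trans (subst (suc k ≤_) k+d≡m (m≤m+n (suc k) d₂)) (m≤n+m m x))

σ-injective : ∀ m {x y} → x ≤ 2 * m → y ≤ 2 * m → σ m x ≡ σ m y → x ≡ y
σ-injective m {x} {y} x≤2m y≤2m σx≡σy with half m x x≤2m | half m y y≤2m
... | lower _ x+d≡m | lower _ y+d≡m =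
  +-cancelʳ-≡ m x y (trans (sym (σ-lower m x x+d≡m)) (trans σx≡σy (σ-lower m y y+d≡m)))
... | lower _ x+d≡m | upper _ _ y≡ k+d≡m = contradiction σx≡σy (σ-lower≢σ-upper m x y x+d≡m y≡ k+d≡m)
... | upper _ _ x≡ k+d≡m | lower _ y+d≡m = contradiction (sym σx≡σy) (σ-lower≢σ-upper m y x y+d≡m x≡ k+d≡m)
... | upper _ _ x≡ _ | upper _ _ y≡ _ =
  trans (sym x≡) (trans (cong (suc m +_) (trans (sym (σ-upper m x x≡)) (trans σx≡σy (σ-upper m y y≡)))) y≡)

τ-injective : ∀ m {x y} → x ≤ 2 * m → y ≤ 2 * m → τ m x ≡ τ m y → x ≡ y
τ-injective m {x} {y} x≤2m y≤2m τx≡τy with half m x x≤2m | half m y y≤2m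
... | lower d x+d≡m | lower d′ y+d′≡m = +-cancelʳ-≡ d x y (trans x+d≡m (trans (sym y+d′≡m) (cong (y +_) (sym d≡d′))))
  where
  d≡d′ : d ≡ d′
  d≡d′ = *-cancelˡ-≡ d d′ 2 (trans (sym (τ-lower m x x+d≡m)) (trans τx≡τy (τ-lower m y y+d′≡m)))
... | lower d x+d≡m | upper _ d′ y≡ k+d≡m =
  contradiction (trans (sym (τ-lower m x x+d≡m)) (trans τx≡τy (τ-upper m y y≡ k+d≡m))) (even≢odd d d′)
... | upper _ d x≡ k+d≡m | lower d′ y+d≡m =
  contradiction (trans (sym (τ-lower m y y+d≡m)) (trans (sym τx≡τy) (τ-upper m x x≡ k+d≡m))) (even≢odd d′ d)
... | upper k d x≡ k+d≡m | upper k′ d′ y≡ k′+d′≡m = trans (sym x≡) (trans (cong (suc m +_) k≡k′) y≡)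
  where
  d≡d′ : d ≡ d′
  d≡d′ = *-cancelˡ-≡ d d′ 2 (suc-injective (trans (sym (τ-upper m x x≡ k+d≡m)) (trans τx≡τy (τ-upper m y y≡ k′+d′≡m))))
  k≡k′ : k ≡ k′
  k≡k′ = suc-injective (+-cancelʳ-≡ d (suc k) (suc k′) (trans k+d≡m (trans (sym k′+d′≡m) (cong (suc k′ +_) (sym d≡d′)))))

column : ℕ → ℕ → ℕ → ℕ
column m 0 x = x
column m 1 x = σ m x
column m 2 x = τ m x
column m 3 x = x
column m 4 x = 2 * m ∸ x
column m (suc (suc (suc (suc (suc j))))) x = column m (suc (suc (suc j))) x

column-≤ : ∀ m j {x} → x ≤ 2 * m → column m j x ≤ 2 * m
column-≤ m 0 x≤2m = x≤2m
column-≤ m 1 x≤2m = σ-≤ m _ x≤2m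
column-≤ m 2 x≤2m = τ-≤ m _ x≤2m
column-≤ m 3 x≤2m = x≤2m
column-≤ m 4 {x} x≤2m = m∸n≤m (2 * m) x
column-≤ m (suc (suc (suc (suc (suc j))))) x≤2m = column-≤ m (suc (suc (suc j))) x≤2m

column-injective : ∀ m j {x y} → x ≤ 2 * m → y ≤ 2 * m → column m j x ≡ column m j y → x ≡ y
column-injective m 0 _ _ eq = eq
column-injective m 1 x≤2m y≤2m eq = σ-injective m x≤2m y≤2m eq
column-injective m 2 x≤2m y≤2m eq = τ-injective m x≤2m y≤2m eq
column-injective m 3 _ _ eq = eq
column-injective m 4 x≤2m y≤2m eq = ∸-cancelˡ-≡ x≤2m y≤2m eq
column-injective m (suc (suc (suc (suc (suc j))))) x≤2m y≤2m eq = column-injective m (suc (suc (suc j))) x≤2m y≤2m eq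

∑-column-pairs : ∀ m t {x} → x ≤ 2 * m → ∑[ j < 2 * t ] column m (3 + toℕ j) x ≡ t * (2 * m)
∑-column-pairs m zero    _ = refl
∑-column-pairs m (suc t) {x} x≤2m = begin
  ∑[ j < 2 * suc t ] column m (3 + toℕ j) x               ≡⟨ cong (λ n → ∑[ j < n ] column m (3 + toℕ j) x) (*-suc 2 t) ⟩
  x + (2 * m ∸ x + ∑[ j < 2 * t ] column m (3 + toℕ j) x) ≡⟨ +-assoc x (2 * m ∸ x) _ ⟨
  x + (2 * m ∸ x) + ∑[ j < 2 * t ] column m (3 + toℕ j) x ≡⟨ cong₂ _+_ (m+[n∸m]≡n x≤2m) (∑-column-pairs m t x≤2m) ⟩
  2 * m + t * (2 * m)                                     ∎
  where open ≡-Reasoning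

∑-columns : ∀ m t {x} → x ≤ 2 * m → ∑[ j < suc (2 * suc t) ] column m (toℕ j) x ≡ 3 * m + t * (2 * m)
∑-columns m t {x} x≤2m = begin
  ∑[ j < suc (2 * suc t) ] column m (toℕ j) x                    ≡⟨ cong (λ n → ∑[ j < suc n ] column m (toℕ j) x) (*-suc 2 t) ⟩
  x + (σ m x + (τ m x + ∑[ j < 2 * t ] column m (3 + toℕ j) x)) ≡⟨ cong (x +_) (+-assoc (σ m x) _ _) ⟨
  x + (σ m x + τ m x + ∑[ j < 2 * t ] column m (3 + toℕ j) x)   ≡⟨ +-assoc x _ _ ⟨
  x + (σ m x + τ m x) + ∑[ j < 2 * t ] column m (3 + toℕ j) x   ≡⟨ cong₂ _+_ (στ-sum m x x≤2m) (∑-column-pairs m t x≤2m) ⟩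
  3 * m + t * (2 * m)                                           ∎
  where open ≡-Reasoning

module MagicLabeling (m n : ℕ) where

  r : ℕ
  r = suc (2 * m)

  row≤2m : (i : Fin r) → toℕ i ≤ 2 * m
  row≤2m i = s≤s⁻¹ (toℕ<n i)

  column-permutation : Fin n → Fin r → Fin r
  column-permutation j i = fromℕ< (s≤s (column-≤ m (toℕ j) (row≤2m i)))

  toℕ-column-permutation : ∀ j i → toℕ (column-permutation j i) ≡ column m (toℕ j) (toℕ i)
  toℕ-column-permutation j i = toℕ-fromℕ< _

  column-permutation-injective : ∀ j → Injective _≡_ _≡_ (column-permutation j)
  column-permutation-injective j {i} {i′} eq = toℕ-injective (column-injective m (toℕ j) (row≤2m i) (row≤2m i′)
    (trans (sym (toℕ-column-permutation j i)) (trans (cong toℕ eq) (toℕ-column-permutation j i′))))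

  magicIndex : Fin r → Fin n → Fin (r * n)
  magicIndex i j = cast (*-comm n r) (combine j (column-permutation j i))

  toℕ-magicIndex : ∀ i j → toℕ (magicIndex i j) ≡ r * toℕ j + column m (toℕ j) (toℕ i)
  toℕ-magicIndex i j = begin
    toℕ (magicIndex i j)                     ≡⟨ toℕ-cast (*-comm n r) _ ⟩
    toℕ (combine j (column-permutation j i)) ≡⟨ toℕ-combine j _ ⟩
    r * toℕ j + toℕ (column-permutation j i) ≡⟨ cong (r * toℕ j +_) (toℕ-column-permutation j i) ⟩
    r * toℕ j + column m (toℕ j) (toℕ i)     ∎
    where open ≡-Reasoning

  magicIndex-injective : ∀ {i j i′ j′} → magicIndex i j ≡ magicIndex i′ j′ → combine i j ≡ combine i′ j′
  magicIndex-injective {i} {j} {i′} {j′} eq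
    with refl , c≡c′ ← combine-injective j _ j′ _ (cast-injective (*-comm n r) eq)
    with refl ← column-permutation-injective j c≡c′ = refl

  magicBijection : Fin (r * n) → Fin (r * n)
  magicBijection e = let i , j = remQuot n e in magicIndex i j

  magicBijection-combine : ∀ i j → magicBijection (combine i j) ≡ magicIndex i j
  magicBijection-combine i j = cong (λ (i , j) → magicIndex i j) (remQuot-combine i j)

  magicBijection-injective : Injective _≡_ _≡_ magicBijection
  magicBijection-injective {e} {e′} eq
    with i , j , refl ← combine-surjective {r} {n} e
    with i′ , j′ , refl ← combine-surjective {r} {n} e′
    = magicIndex-injective (trans (sym (magicBijection-combine i j)) (trans eq (magicBijection-combine i′ j′)))

  magicLabeling : Labeling (starForest r n)
  magicLabeling = record { f = magicBijection ; f-bij = magicBijection-injective , injective⇒surjective magicBijection-injective }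

  label-magic : ∀ i j → label magicLabeling (combine i j) ≡ suc (r * toℕ j + column m (toℕ j) (toℕ i))
  label-magic i j = cong suc (trans (cong toℕ (magicBijection-combine i j)) (toℕ-magicIndex i j))

  open StarForest r n using (centre; weight-centre)

  weight-centre-magic : ∀ i → weight magicLabeling (centre i) ≡
                              ∑[ j < n ] suc (r * toℕ j) + ∑[ j < n ] column m (toℕ j) (toℕ i)
  weight-centre-magic i = begin
    weight magicLabeling (centre i)                                  ≡⟨ weight-centre magicLabeling i ⟩
    ∑[ j < n ] label magicLabeling (combine i j)                     ≡⟨ sum-cong-≗ (label-magic i) ⟩
    ∑[ j < n ] (suc (r * toℕ j) + column m (toℕ j) (toℕ i))          ≡⟨ ∑-distrib-+ {n} _ _ ⟩
    ∑[ j < n ] suc (r * toℕ j) + ∑[ j < n ] column m (toℕ j) (toℕ i) ∎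
    where open ≡-Reasoning

mainTheorem6 : (r n : ℕ) → Odd r → Odd n → 3 ≤ n →
    ChiLaIs (starForest r n) (r * n + 1)
mainTheorem6 r n (m , refl) (zero , refl) (s≤s ())
mainTheorem6 r n (m , refl) (suc t , refl) _ =
  (magicLabeling , isLocalAntimagic magicLabeling 1<n ,
    ≤-antisym (numWeights-upper magicLabeling R centres≡R) (numWeights-lower magicLabeling 1<n)) ,
  λ L _ → numWeights-lower L 1<n
  where
  open MagicLabeling m n using (magicLabeling; weight-centre-magic; row≤2m)
  open StarForest r n using (centre; isLocalAntimagic; numWeights-lower; numWeights-upper)
  1<n : 1 < n
  1<n = s≤s (s≤s z≤n)
  R : ℕ
  R = ∑[ j < n ] suc (r * toℕ j) + (3 * m + t * (2 * m))
  centres≡R : ∀ i → weight magicLabeling (centre i) ≡ R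
  centres≡R i = trans (weight-centre-magic i) (cong (∑[ j < n ] suc (r * toℕ j) +_) (∑-columns m t (row≤2m i)))
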